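{- Let $P\in\mathcal{C}(G_n)$, and let $T\subseteq Q_{n}$. Then $T\in \mathrm{char}(P)$ if and only if $T^k\in \mathrm{char}(\mathrm{weave}_k^1(P))$.
   Context: Let $Q_n=\{1,\dots,n\}$ be a set of $n$ yes/no questions; an outcome on $S\subseteq Q_n$ is an element of $\{0,1\}^{|S|}$, and $X_S$ is the set of outcomes on $S$. A preference matrix on $Q_n$ is a $2^n\times n$ 0-1 matrix whose rows are the $2^n$ outcomes, each exactly once, ordered from most to least preferred. For a nonempty proper $S\subset Q_n$ and outcome $x$ on $Q_n-S$, $P^{[Q_n-S,x]}$ is the submatrix formed by the columns in $S$ and rows with outcome $x$ on $Q_n-S$ (in order); $S$ is separable with respect to $P$ if $P^{[Q_n-S,x]}=P^{[Q_n-S,y]}$ for all $x,y\in X_{Q_n-S}$; $\emptyset$ and $Q_n$ are always separable. The character $\mathrm{char}(P)$ is the set of all subsets of $Q_n$ separable with respect to $P$. $\mathcal{C}(G_n)$ is the set of preference matrices generated by Hamiltonian paths in the $n$-dimensional hypercube graph $G_n$ with Gray code labeling, i.e. preference matrices in which consecutive rows differ in exactly one entry. For $A\in\mathcal{C}(G_n)$ and $k\in\{1,\dots,n+1\}$, $\mathrm{weave}_k^1(A)$ is the $2^{n+1}\times(n+1)$ matrix obtained by duplicating each row of $A$ (rows $2i-1$ and $2i$ both equal row $i$ of $A$) and inserting a new column in position $k$ (shifting later columns right) whose $i$-th entry is $1$ if $i\equiv 0,1 \pmod 4$ and $0$ if $i\equiv 2,3\pmod 4$. For $T\subseteq Q_n$,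 $T^k=\{q\in T : q<k\}\cup\{q+1 : q\in T \text{ and } q \geq k\}$. -}

module Defs where

open import Data.Bool using (Bool; true; false; not; _∨_)
open import Data.Bool.Properties using () renaming (_≟_ to _≟ᵇ_)
open import Data.Nat using (ℕ; zero; suc; _+_; _*_; _^_; _%_)
open import Data.Nat.Properties using () renaming (_≟_ to _≟ℕ_)
open import Data.Fin using (Fin)
open import Data.Fin.Subset using (Subset; ∁; ∣_∣; ⊥; ⊤)
open import Data.List using (List; []; _∷_; length; map; filter; concatMap; zipWith; upTo; allFin)
import Data.List.Properties as LP
open import Data.List.Relation.Unary.Linked using (Linked)
open import Data.Vec using (Vec; lookup; insertAt)
import Data.Vec.Properties as VP
open import Data.Product using (∃; _×_)
open import Data.Sum using (_⊎_)
open import Relation.Binary.PropositionalEquality using (_≡_; _≢_)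
open import Relation.Nullary using (does)

-- Questions Q_n = {1,…,n} are represented 0-indexed by Fin n.
-- An outcome on Q_n is a row Vec Bool n (true = 1, false = 0).
Outcome : ℕ → Set
Outcome n = Vec Bool n

-- A matrix with n columns, given as its list of rows (top = most preferred).
Matrix : ℕ → Set
Matrix n = List (Outcome n)

occurrences : ∀ {n} → Outcome n → Matrix n → ℕ
occurrences x rows = length (filter (λ r → VP.≡-dec _≟ᵇ_ r x) rows)

IsPreferenceMatrix : ∀ {n} → Matrix n → Set
IsPreferenceMatrix {n} P = length P ≡ 2 ^ n × (∀ (x : Outcome n) → occurrences x P ≡ 1)

DifferInOne : ∀ {n} → Outcome n → Outcome n → Set
DifferInOne {n} x y = ∃ λ (j : Fin n) → lookup x j ≢ lookup y j × (∀ (i : Fin n) → i ≢ j → lookup x i ≡ lookup y i)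

InCG : ∀ {n} → Matrix n → Set
InCG P = IsPreferenceMatrix P × Linked DifferInOne P

restrict : ∀ {n} → Subset n → Outcome n → List Bool
restrict {n} S r = map (lookup r) (filter (λ j → lookup S j ≟ᵇ true) (allFin n))

subMatrix : ∀ {n} → Matrix n → Subset n → List Bool → List (List Bool)
subMatrix P S x = map (restrict S) (filter (λ r → LP.≡-dec _≟ᵇ_ (restrict (∁ S) r) x) P)

IsOutcomeOn : ∀ {n} → Subset n → List Bool → Set
IsOutcomeOn S x = length x ≡ ∣ S ∣

-- S is separable w.r.t. P (∅ and Q_n always separable)
Separable : ∀ {n} → Matrix n → Subset n → Set
Separable P S = S ≡ ⊥ ⊎ S ≡ ⊤ ⊎
  (∀ (x y : List Bool) → IsOutcomeOn (∁ S) x → IsOutcomeOn (∁ S) y → subMatrix P S x ≡ subMatrix P S y)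

_∈char_ : ∀ {n} → Subset n → Matrix n → Set
S ∈char P = Separable P S

-- new column entry for (1-indexed) row i: 1 iff i ≡ 0,1 (mod 4)
newCol : ℕ → Bool
newCol i = does ((i % 4) ≟ℕ 0) ∨ does ((i % 4) ≟ℕ 1)

duplicateRows : ∀ {n} → Matrix n → Matrix n
duplicateRows A = concatMap (λ r → r ∷ r ∷ []) A

-- weave_k^1(A); position k ∈ {1,…,n+1} is represented 0-indexed by k : Fin (suc n)
weave : ∀ {n} → Fin (suc n) → Matrix n → Matrix (suc n)
weave k A = zipWith (λ i r → insertAt r k (newCol (suc i))) (upTo (length D)) D
  where D = duplicateRows A

-- T^k (0-indexed: the new position k is not in T^k, positions ≥ k shift by one)
shiftSet : ∀ {n} → Fin (suc n) → Subset n → Subset (suc n)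
shiftSet k T = insertAt T k false

-- Weaving duplicates every row r of P as the pair (r with b inserted at k, r with ¬b inserted
-- at k). For an outcome on the complement of T^k, the bit in column k selects exactly one row
-- of each pair, and the remaining bits select rows of P with the corresponding outcome on the
-- complement of T; restricted to T^k, the selected rows are the rows of P restricted to T.
-- Hence every submatrix of weave_k^1(P) for T^k is a submatrix of P for T and conversely, and
-- T^k is empty iff T is.

module Submission where

open import Defs
open import Data.Nat using (ℕ; suc)
open import Data.Fin using (Fin)
open import Data.Fin.Subset using (Subset)
open import Function.Bundles using (_⇔_)

open import Data.Bool using (Bool; true; false; not; _∨_)
open import Data.Bool.Properties using (not-¬) renaming (_≟_ to _≟ᵇ_)
open import Data.Nat using (zero; _+_; _∸_; _%_)
open import Data.Nat.DivMod using ([m+n]%n≡m%n)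
import Data.Nat.Properties as ℕ
open import Data.Fin using (zero; suc)
open import Data.Fin.Subset using (∁; ∣_∣; ⊥; ⊤)
open import Data.Fin.Subset.Properties using (∣∁p∣≡n∸∣p∣; ∣⊤∣≡n)
open import Data.List using (List; []; _∷_; length; map; filter; applyUpTo; zipWith; tabulate)
import Data.List.Properties as List
open import Data.Vec using (Vec; lookup; insertAt; removeAt) renaming ([] to []ᵛ; _∷_ to _∷ᵛ_)
open import Data.Vec.Properties using (removeAt-insertAt)
open import Data.Product using (∃₂; _×_; _,_; proj₁; proj₂)
open import Data.Sum using (_⊎_; inj₁; inj₂; map₂)
open import Data.Sum.Function.Propositional using (_⊎-⇔_)
open import Data.Empty using (⊥-elim)
open import Function.Base using (_∘_)
open import Function.Bundles using (mk⇔)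
import Function.Properties.Equivalence as ⇔
open import Relation.Binary.PropositionalEquality
open import Relation.Nullary using (Dec; yes; no; does)

open ≡-Reasoning

select : ∀ {n} → Subset n → Outcome n → List Bool
select []ᵛ           []ᵛ       = []
select (true ∷ᵛ S)  (x ∷ᵛ r) = x ∷ select S r
select (false ∷ᵛ S) (x ∷ᵛ r) = select S r

-- restrict filters the enumeration allFin n = tabulate id of the columns; generalising id to
-- an arbitrary f lets the induction peel off the first column.
restrictAlong≡select : ∀ {n m} (S r : Vec Bool n) (S′ r′ : Vec Bool m) (f : Fin n → Fin m) →
  (∀ i → lookup S′ (f i) ≡ lookup S i) → (∀ i → lookup r′ (f i) ≡ lookup r i) →
  map (lookup r′) (filter (λ j → lookup S′ j ≟ᵇ true) (tabulate f)) ≡ select S r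
restrictAlong≡select []ᵛ []ᵛ S′ r′ f S≗ r≗ = refl
restrictAlong≡select (true ∷ᵛ S) (x ∷ᵛ r) S′ r′ f S≗ r≗ = begin
  map (lookup r′) (filter inS′? (tabulate f))
    ≡⟨ cong (map (lookup r′)) (List.filter-accept inS′? (S≗ zero)) ⟩
  lookup r′ (f zero) ∷ map (lookup r′) (filter inS′? (tabulate (f ∘ suc)))
    ≡⟨ cong₂ _∷_ (r≗ zero) (restrictAlong≡select S r S′ r′ (f ∘ suc) (S≗ ∘ suc) (r≗ ∘ suc)) ⟩
  x ∷ select S r ∎
  where
  inS′? = λ j → lookup S′ j ≟ᵇ true
restrictAlong≡select (false ∷ᵛ S) (x ∷ᵛ r) S′ r′ f S≗ r≗ = begin
  map (lookup r′) (filter inS′? (tabulate f))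
    ≡⟨ cong (map (lookup r′)) (List.filter-reject inS′? (not-¬ refl ∘ trans (sym (S≗ zero)))) ⟩
  map (lookup r′) (filter inS′? (tabulate (f ∘ suc)))
    ≡⟨ restrictAlong≡select S r S′ r′ (f ∘ suc) (S≗ ∘ suc) (r≗ ∘ suc) ⟩
  select S r ∎
  where
  inS′? = λ j → lookup S′ j ≟ᵇ true

restrict≡select : ∀ {n} (S r : Vec Bool n) → restrict S r ≡ select S r
restrict≡select S r = restrictAlong≡select S r S r (λ i → i) (λ _ → refl) (λ _ → refl)

-- insertOn S k b x inserts b into an outcome x on S at the place that column k takes in the
-- outcome on insertAt S k true; its value on lists of the wrong length is irrelevant.
insertOn : ∀ {n} → Subset n → Fin (suc n) → Bool → List Bool → List Bool
insertOn S             zero    b xs       = b ∷ xs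
insertOn (true ∷ᵛ S)  (suc k) b []       = b ∷ []
insertOn (true ∷ᵛ S)  (suc k) b (x ∷ xs) = x ∷ insertOn S k b xs
insertOn (false ∷ᵛ S) (suc k) b xs       = insertOn S k b xs

insertOn-≢-[] : ∀ {n} (S : Subset n) k b xs → insertOn S k b xs ≢ []
insertOn-≢-[] S             zero    b xs       ()
insertOn-≢-[] (true ∷ᵛ S)  (suc k) b []       ()
insertOn-≢-[] (true ∷ᵛ S)  (suc k) b (x ∷ xs) ()
insertOn-≢-[] (false ∷ᵛ S) (suc k) b xs       = insertOn-≢-[] S k b xs

insertOn-injective : ∀ {n} (S : Subset n) k {b c xs ys} →
  insertOn S k b xs ≡ insertOn S k c ys → b ≡ c × xs ≡ ys
insertOn-injective S zero refl = refl , refl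
insertOn-injective (true ∷ᵛ S) (suc k) {xs = []}     {[]}     refl = refl , refl
insertOn-injective (true ∷ᵛ S) (suc k) {xs = []}     {y ∷ ys} e =
  ⊥-elim (insertOn-≢-[] S k _ ys (sym (List.∷-injectiveʳ e)))
insertOn-injective (true ∷ᵛ S) (suc k) {xs = x ∷ xs} {[]}     e =
  ⊥-elim (insertOn-≢-[] S k _ xs (List.∷-injectiveʳ e))
insertOn-injective (true ∷ᵛ S) (suc k) {xs = x ∷ xs} {y ∷ ys} e
  with refl ← List.∷-injectiveˡ e
  with b≡c , refl ← insertOn-injective S k (List.∷-injectiveʳ e) = b≡c , refl
insertOn-injective (false ∷ᵛ S) (suc k) e = insertOn-injective S k e

insertOn-isOutcomeOn : ∀ {n} (S : Subset n) k b {xs} →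
  IsOutcomeOn S xs → IsOutcomeOn (insertAt S k true) (insertOn S k b xs)
insertOn-isOutcomeOn S             zero    b       ∣xs∣ = cong suc ∣xs∣
insertOn-isOutcomeOn (true ∷ᵛ S)  (suc k) b {x ∷ xs} ∣xs∣ =
  cong suc (insertOn-isOutcomeOn S k b (ℕ.suc-injective ∣xs∣))
insertOn-isOutcomeOn (false ∷ᵛ S) (suc k) b       ∣xs∣ = insertOn-isOutcomeOn S k b ∣xs∣

insertOn-surjective : ∀ {n} (S : Subset n) k {ys} → IsOutcomeOn (insertAt S k true) ys →
  ∃₂ λ b xs → IsOutcomeOn S xs × ys ≡ insertOn S k b xs
insertOn-surjective S zero {b ∷ xs} ∣ys∣ = b , xs , ℕ.suc-injective ∣ys∣ , refl
insertOn-surjective (true ∷ᵛ S) (suc k) {y ∷ ys} ∣ys∣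
  with b , xs , ∣xs∣ , refl ← insertOn-surjective S k {ys} (ℕ.suc-injective ∣ys∣) =
  b , y ∷ xs , cong suc ∣xs∣ , refl
insertOn-surjective (false ∷ᵛ S) (suc k) ∣ys∣ = insertOn-surjective S k ∣ys∣

select-insertAt-false : ∀ {n} (S r : Vec Bool n) k c →
  select (insertAt S k false) (insertAt r k c) ≡ select S r
select-insertAt-false S             r          zero    c = refl
select-insertAt-false (true ∷ᵛ S)  (x ∷ᵛ r) (suc k) c = cong (x ∷_) (select-insertAt-false S r k c)
select-insertAt-false (false ∷ᵛ S) (x ∷ᵛ r) (suc k) c = select-insertAt-false S r k c

select-insertAt-true : ∀ {n} (S r : Vec Bool n) k c →
  select (insertAt S k true) (insertAt r k c) ≡ insertOn S k c (select S r)
select-insertAt-true S             r          zero    c = refl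
select-insertAt-true (true ∷ᵛ S)  (x ∷ᵛ r) (suc k) c = cong (x ∷_) (select-insertAt-true S r k c)
select-insertAt-true (false ∷ᵛ S) (x ∷ᵛ r) (suc k) c = select-insertAt-true S r k c

∁-insertAt : ∀ {n} (S : Subset n) k b → ∁ (insertAt S k b) ≡ insertAt (∁ S) k (not b)
∁-insertAt S        zero    b = refl
∁-insertAt (x ∷ᵛ S) (suc k) b = cong (not x ∷ᵛ_) (∁-insertAt S k b)

restrict-shiftSet : ∀ {n} (T r : Vec Bool n) k c →
  restrict (shiftSet k T) (insertAt r k c) ≡ restrict T r
restrict-shiftSet T r k c = begin
  restrict (insertAt T k false) (insertAt r k c) ≡⟨ restrict≡select (insertAt T k false) (insertAt r k c) ⟩
  select (insertAt T k false) (insertAt r k c)   ≡⟨ select-insertAt-false T r k c ⟩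
  select T r                                     ≡⟨ restrict≡select T r ⟨
  restrict T r                                   ∎

restrict-∁-shiftSet : ∀ {n} (T r : Vec Bool n) k c →
  restrict (∁ (shiftSet k T)) (insertAt r k c) ≡ insertOn (∁ T) k c (restrict (∁ T) r)
restrict-∁-shiftSet T r k c = begin
  restrict (∁ (insertAt T k false)) (insertAt r k c) ≡⟨ cong (λ S → restrict S (insertAt r k c)) (∁-insertAt T k false) ⟩
  restrict (insertAt (∁ T) k true) (insertAt r k c)  ≡⟨ restrict≡select (insertAt (∁ T) k true) (insertAt r k c) ⟩
  select (insertAt (∁ T) k true) (insertAt r k c)    ≡⟨ select-insertAt-true (∁ T) r k c ⟩
  insertOn (∁ T) k c (select (∁ T) r)                ≡⟨ cong (insertOn (∁ T) k c) (restrict≡select (∁ T) r) ⟨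
  insertOn (∁ T) k c (restrict (∁ T) r)              ∎

weaveBit : Bool → ℕ → Bool
weaveBit p zero          = p
weaveBit p (suc zero)    = not p
weaveBit p (suc (suc i)) = weaveBit (not p) i

weaveFrom : ∀ {n} → Bool → Fin (suc n) → Matrix n → Matrix (suc n)
weaveFrom p k []      = []
weaveFrom p k (r ∷ A) = insertAt r k p ∷ insertAt r k (not p) ∷ weaveFrom (not p) k A

newCol-+4 : ∀ i → newCol (4 + i) ≡ newCol i
newCol-+4 i = cong (λ m → does (m ℕ.≟ 0) ∨ does (m ℕ.≟ 1))
  (trans (cong (_% 4) (ℕ.+-comm 4 i)) ([m+n]%n≡m%n i 4))

newCol-suc : ∀ i → newCol (suc i) ≡ weaveBit true i
newCol-suc zero                      = refl
newCol-suc (suc zero)                = refl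
newCol-suc (suc (suc zero))          = refl
newCol-suc (suc (suc (suc zero)))    = refl
newCol-suc (suc (suc (suc (suc i)))) = trans (newCol-+4 (suc i)) (newCol-suc i)

zipWith-newCol≡weaveFrom : ∀ {n} k (A : Matrix n) (f : ℕ → ℕ) p →
  (∀ i → newCol (suc (f i)) ≡ weaveBit p i) →
  zipWith (λ i r → insertAt r k (newCol (suc i))) (applyUpTo f (length (duplicateRows A))) (duplicateRows A)
    ≡ weaveFrom p k A
zipWith-newCol≡weaveFrom k []      f p f≗ = refl
zipWith-newCol≡weaveFrom k (r ∷ A) f p f≗ =
  cong₂ _∷_ (cong (insertAt r k) (f≗ 0))
    (cong₂ _∷_ (cong (insertAt r k) (f≗ 1))
      (zipWith-newCol≡weaveFrom k A (λ i → f (2 + i)) (not p) (λ i → f≗ (2 + i))))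

weave≡weaveFrom : ∀ {n} k (A : Matrix n) → weave k A ≡ weaveFrom true k A
weave≡weaveFrom k A = zipWith-newCol≡weaveFrom k A (λ i → i) true newCol-suc

hasOutcome : ∀ {n} (S : Subset n) (x : List Bool) (r : Outcome n) → Dec (restrict S r ≡ x)
hasOutcome S x r = List.≡-dec _≟ᵇ_ (restrict S r) x

shiftSet-outcome-inv : ∀ {n} (T : Subset n) k {b x r c} →
  restrict (∁ (shiftSet k T)) (insertAt r k c) ≡ insertOn (∁ T) k b x → c ≡ b × restrict (∁ T) r ≡ x
shiftSet-outcome-inv T k {r = r} {c} e = insertOn-injective (∁ T) k (trans (sym (restrict-∁-shiftSet T r k c)) e)

bit-cases : ∀ p b → b ≡ p ⊎ b ≡ not p
bit-cases false false = inj₁ refl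
bit-cases false true  = inj₂ refl
bit-cases true  false = inj₂ refl
bit-cases true  true  = inj₁ refl

filter-weaveFrom : ∀ {n} (T : Subset n) k b x p (A : Matrix n) →
  filter (hasOutcome (∁ (shiftSet k T)) (insertOn (∁ T) k b x)) (weaveFrom p k A)
    ≡ map (λ r → insertAt r k b) (filter (hasOutcome (∁ T) x) A)
filter-weaveFrom T k b x p [] = refl
filter-weaveFrom T k b x p (r ∷ A) with hasOutcome (∁ T) x r | bit-cases p b
... | yes r∼x | inj₁ refl = begin
  filter D (insertAt r k b ∷ insertAt r k (not b) ∷ rest)
    ≡⟨ List.filter-accept D (accept r∼x) ⟩
  insertAt r k b ∷ filter D (insertAt r k (not b) ∷ rest)
    ≡⟨ cong (insertAt r k b ∷_) (List.filter-reject D (not-¬ refl ∘ sym ∘ proj₁ ∘ shiftSet-outcome-inv T k)) ⟩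
  insertAt r k b ∷ filter D rest
    ≡⟨ cong (insertAt r k b ∷_) (filter-weaveFrom T k b x (not b) A) ⟩
  insertAt r k b ∷ map (λ r → insertAt r k b) (filter (hasOutcome (∁ T) x) A) ∎
  where
  D = hasOutcome (∁ (shiftSet k T)) (insertOn (∁ T) k b x)
  rest = weaveFrom (not b) k A
  accept : restrict (∁ T) r ≡ x → restrict (∁ (shiftSet k T)) (insertAt r k b) ≡ insertOn (∁ T) k b x
  accept r∼x = trans (restrict-∁-shiftSet T r k b) (cong (insertOn (∁ T) k b) r∼x)
... | yes r∼x | inj₂ refl = begin
  filter D (insertAt r k p ∷ insertAt r k (not p) ∷ rest)
    ≡⟨ List.filter-reject D (not-¬ refl ∘ proj₁ ∘ shiftSet-outcome-inv T k) ⟩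
  filter D (insertAt r k (not p) ∷ rest)
    ≡⟨ List.filter-accept D (accept r∼x) ⟩
  insertAt r k (not p) ∷ filter D rest
    ≡⟨ cong (insertAt r k (not p) ∷_) (filter-weaveFrom T k (not p) x (not p) A) ⟩
  insertAt r k (not p) ∷ map (λ r → insertAt r k (not p)) (filter (hasOutcome (∁ T) x) A) ∎
  where
  D = hasOutcome (∁ (shiftSet k T)) (insertOn (∁ T) k (not p) x)
  rest = weaveFrom (not p) k A
  accept : restrict (∁ T) r ≡ x → restrict (∁ (shiftSet k T)) (insertAt r k (not p)) ≡ insertOn (∁ T) k (not p) x
  accept r∼x = trans (restrict-∁-shiftSet T r k (not p)) (cong (insertOn (∁ T) k (not p)) r∼x)
... | no r≁x | _ = begin
  filter D (insertAt r k p ∷ insertAt r k (not p) ∷ rest)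
    ≡⟨ List.filter-reject D (r≁x ∘ proj₂ ∘ shiftSet-outcome-inv T k) ⟩
  filter D (insertAt r k (not p) ∷ rest)
    ≡⟨ List.filter-reject D (r≁x ∘ proj₂ ∘ shiftSet-outcome-inv T k) ⟩
  filter D rest
    ≡⟨ filter-weaveFrom T k b x (not p) A ⟩
  map (λ r → insertAt r k b) (filter (hasOutcome (∁ T) x) A) ∎
  where
  D = hasOutcome (∁ (shiftSet k T)) (insertOn (∁ T) k b x)
  rest = weaveFrom (not p) k A

subMatrix-weave : ∀ {n} (P : Matrix n) (T : Subset n) k b x →
  subMatrix (weave k P) (shiftSet k T) (insertOn (∁ T) k b x) ≡ subMatrix P T x
subMatrix-weave P T k b x = begin
  map (restrict (shiftSet k T)) (filter D (weave k P))
    ≡⟨ cong (map (restrict (shiftSet k T)) ∘ filter D) (weave≡weaveFrom k P) ⟩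
  map (restrict (shiftSet k T)) (filter D (weaveFrom true k P))
    ≡⟨ cong (map (restrict (shiftSet k T))) (filter-weaveFrom T k b x true P) ⟩
  map (restrict (shiftSet k T)) (map (λ r → insertAt r k b) (filter (hasOutcome (∁ T) x) P))
    ≡⟨ List.map-∘ (filter (hasOutcome (∁ T) x) P) ⟨
  map (λ r → restrict (shiftSet k T) (insertAt r k b)) (filter (hasOutcome (∁ T) x) P)
    ≡⟨ List.map-cong (λ r → restrict-shiftSet T r k b) (filter (hasOutcome (∁ T) x) P) ⟩
  map (restrict T) (filter (hasOutcome (∁ T) x) P) ∎
  where
  D = hasOutcome (∁ (shiftSet k T)) (insertOn (∁ T) k b x)

SubMatricesAgree : ∀ {n} → Matrix n → Subset n → Set
SubMatricesAgree P S =
  ∀ x y → IsOutcomeOn (∁ S) x → IsOutcomeOn (∁ S) y → subMatrix P S x ≡ subMatrix P S y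

subMatricesAgree-⊤ : ∀ {n} (P : Matrix n) → SubMatricesAgree P ⊤
subMatricesAgree-⊤ {n} P x y ∣x∣ ∣y∣ = cong (subMatrix P ⊤) (trans (empty ∣x∣) (sym (empty ∣y∣)))
  where
  ∣∁⊤∣≡0 : ∣ ∁ (⊤ {n}) ∣ ≡ 0
  ∣∁⊤∣≡0 = trans (∣∁p∣≡n∸∣p∣ (⊤ {n})) (trans (cong (n ∸_) (∣⊤∣≡n n)) (ℕ.n∸n≡0 n))
  empty : ∀ {z} → IsOutcomeOn (∁ (⊤ {n})) z → z ≡ []
  empty {[]}    _   = refl
  empty {_ ∷ _} ∣z∣ = ⊥-elim (ℕ.1+n≢0 (trans ∣z∣ ∣∁⊤∣≡0))

separable⇔ : ∀ {n} (P : Matrix n) S → Separable P S ⇔ (S ≡ ⊥ ⊎ SubMatricesAgree P S)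
separable⇔ P S = mk⇔ to (map₂ inj₂)
  where
  to : Separable P S → S ≡ ⊥ ⊎ SubMatricesAgree P S
  to (inj₁ S≡⊥)         = inj₁ S≡⊥
  to (inj₂ (inj₁ refl))  = inj₂ (subMatricesAgree-⊤ P)
  to (inj₂ (inj₂ agree)) = inj₂ agree

insertAt-injective : ∀ {a} {A : Set a} {n} {xs ys : Vec A n} k {v} → insertAt xs k v ≡ insertAt ys k v → xs ≡ ys
insertAt-injective {xs = xs} {ys} k {v} e = begin
  xs                             ≡⟨ removeAt-insertAt xs k v ⟨
  removeAt (insertAt xs k v) k   ≡⟨ cong (λ zs → removeAt zs k) e ⟩
  removeAt (insertAt ys k v) k   ≡⟨ removeAt-insertAt ys k v ⟩
  ys                             ∎

shiftSet-⊥ : ∀ {n} (k : Fin (suc n)) → shiftSet k ⊥ ≡ ⊥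
shiftSet-⊥ zero            = refl
shiftSet-⊥ {suc n} (suc k) = cong (false ∷ᵛ_) (shiftSet-⊥ k)

≡⊥⇔shiftSet≡⊥ : ∀ {n} (T : Subset n) k → T ≡ ⊥ ⇔ shiftSet k T ≡ ⊥
≡⊥⇔shiftSet≡⊥ T k = mk⇔
  (λ { refl → shiftSet-⊥ k })
  (λ e → insertAt-injective k (trans e (sym (shiftSet-⊥ k))))

subMatricesAgree-weave⇔ : ∀ {n} (P : Matrix n) T k →
  SubMatricesAgree P T ⇔ SubMatricesAgree (weave k P) (shiftSet k T)
subMatricesAgree-weave⇔ P T k = mk⇔ to from
  where
  ∣∁shiftSet∣ : ∣ ∁ (shiftSet k T) ∣ ≡ ∣ insertAt (∁ T) k true ∣
  ∣∁shiftSet∣ = cong ∣_∣ (∁-insertAt T k false)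
  to : SubMatricesAgree P T → SubMatricesAgree (weave k P) (shiftSet k T)
  to agree x′ y′ ∣x′∣ ∣y′∣
    with b , x , ∣x∣ , refl ← insertOn-surjective (∁ T) k {x′} (trans ∣x′∣ ∣∁shiftSet∣)
       | c , y , ∣y∣ , refl ← insertOn-surjective (∁ T) k {y′} (trans ∣y′∣ ∣∁shiftSet∣) = begin
    subMatrix (weave k P) (shiftSet k T) (insertOn (∁ T) k b x) ≡⟨ subMatrix-weave P T k b x ⟩
    subMatrix P T x                                             ≡⟨ agree x y ∣x∣ ∣y∣ ⟩
    subMatrix P T y                                             ≡⟨ subMatrix-weave P T k c y ⟨
    subMatrix (weave k P) (shiftSet k T) (insertOn (∁ T) k c y) ∎
  from : SubMatricesAgree (weave k P) (shiftSet k T) → SubMatricesAgree P T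
  from agree x y ∣x∣ ∣y∣ = begin
    subMatrix P T x                                                ≡⟨ subMatrix-weave P T k true x ⟨
    subMatrix (weave k P) (shiftSet k T) (insertOn (∁ T) k true x) ≡⟨ agree _ _ (lift ∣x∣) (lift ∣y∣) ⟩
    subMatrix (weave k P) (shiftSet k T) (insertOn (∁ T) k true y) ≡⟨ subMatrix-weave P T k true y ⟩
    subMatrix P T y                                                ∎
    where
    lift : ∀ {z} → IsOutcomeOn (∁ T) z → IsOutcomeOn (∁ (shiftSet k T)) (insertOn (∁ T) k true z)
    lift ∣z∣ = trans (insertOn-isOutcomeOn (∁ T) k true ∣z∣) (sym ∣∁shiftSet∣)

lemma9 : (n : ℕ) (P : Matrix n) → InCG P → (T : Subset n) (k : Fin (suc n)) →
    (T ∈char P) ⇔ (shiftSet k T ∈char weave k P)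
lemma9 n P _ T k =
  ⇔.trans (separable⇔ P T)
    (⇔.trans (≡⊥⇔shiftSet≡⊥ T k ⊎-⇔ subMatricesAgree-weave⇔ P T k)
      (⇔.sym (separable⇔ (weave k P) (shiftSet k T))))
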